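{- For a finite simple graph $G$ with at least one edge, the Edge-compelling chromatic number of $G$ is at least $\chi(G)$ and at most $\chi(G)+2$.
   Context: A proper coloring partitions $V(G)$ into nonempty independent color classes; a rainbow committee (RC) is a set consisting of exactly one vertex of each color. Property Edge: at least one pair of vertices of the RC is joined by an edge. A proper coloring is Edge-compelling if every RC has property Edge; the Edge-compelling chromatic number is the minimum number of colors in an Edge-compelling proper coloring. $\chi(G)$ is the chromatic number. -}

module Defs where

open import Data.Nat using (ℕ; _≤_)
open import Data.Fin using (Fin)
open import Data.Bool using (Bool; true; false)
open import Data.Product using (Σ; _×_; ∃-syntax; proj₁)
open import Relation.Binary.PropositionalEquality using (_≡_; _≢_)

record Graph : Set where
  field
    n     : ℕ
    adj   : Fin n → Fin n → Bool
    sym   : ∀ u v → adj u v ≡ adj v u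
    irrefl : ∀ v → adj v v ≡ false
open Graph public

Vertex : Graph → Set
Vertex G = Fin (n G)

Edge : (G : Graph) → Vertex G → Vertex G → Set
Edge G u v = adj G u v ≡ true

HasEdge : Graph → Set
HasEdge G = ∃[ u ] ∃[ v ] Edge G u v

record ProperColoring (G : Graph) (k : ℕ) : Set where
  field
    color    : Vertex G → Fin k
    nonempty : ∀ (i : Fin k) → ∃[ v ] color v ≡ i
    proper   : ∀ u v → Edge G u v → color u ≢ color v
open ProperColoring public

RainbowCommittee : {G : Graph} {k : ℕ} → ProperColoring G k → Set
RainbowCommittee {G} {k} c = Σ (Fin k → Vertex G) λ r → ∀ i → color c (r i) ≡ i

PropertyEdge : {G : Graph} {k : ℕ} (c : ProperColoring G k) → RainbowCommittee c → Set
PropertyEdge {G} {k} c R = ∃[ i ] ∃[ j ] Edge G (proj₁ R i) (proj₁ R j)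

EdgeCompelling : {G : Graph} {k : ℕ} → ProperColoring G k → Set
EdgeCompelling c = ∀ (R : RainbowCommittee c) → PropertyEdge c R

IsMinimum : (ℕ → Set) → ℕ → Set
IsMinimum P m = P m × (∀ k → P k → m ≤ k)

Colorable : Graph → ℕ → Set
Colorable G k = ProperColoring G k

EdgeCompellingColorable : Graph → ℕ → Set
EdgeCompellingColorable G k = Σ (ProperColoring G k) EdgeCompelling

IsChromaticNumber : Graph → ℕ → Set
IsChromaticNumber G χ = IsMinimum (Colorable G) χ

IsEdgeCompellingChromaticNumber : Graph → ℕ → Set
IsEdgeCompellingChromaticNumber G m = IsMinimum (EdgeCompellingColorable G) m

-- A proper χ-coloring c and an edge uv give an Edge-compelling coloring
-- with at most χ + 2 colors: give u and v new colors of their own and drop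
-- the colors of c that are left unused.  Every rainbow committee must then
-- contain u and v, hence the edge uv.  Every Edge-compelling coloring is a
-- proper coloring, so the minimum m exists and satisfies χ ≤ m ≤ χ + 2; the
-- minimum can be found because colorability by k colors is decidable, by
-- exhaustive search over all maps between finite sets.
module Submission where

open import Defs hiding (sym)
open import Data.Nat using (ℕ; _≤_; _<_; _+_; zero; suc; z≤n)
open import Data.Nat.Properties using (≤-refl; ≤-trans; ≤-reflexive; m≤n⇒m≤1+n; +-comm; +-suc; +-identityʳ; m≤m+n; ≮⇒≥; m<1+n⇒m<n∨m≡n)
open import Data.Product using (Σ; _×_; _,_; proj₁; ∃; ∃-syntax)
open import Data.Sum using (inj₁; inj₂)
open import Data.Bool using (true)
import Data.Bool.Properties as Bool
open import Data.Fin as Fin using (Fin; punchOut)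
open import Data.Fin.Properties using (_≟_; all?; any?; ¬∀⟶∃¬; punchOut-injective; suc-injective)
open import Data.Vec.Functional using (_∷_; head; tail)
open import Data.Vec.Functional.Properties using (∷-cong)
open import Function using (_∘_; id)
open import Function.Definitions using (StrictlySurjective)
open import Relation.Nullary using (Dec; yes; no; ¬_; contradiction)
open import Relation.Nullary.Decidable using (map′; decidable-stable; ¬?; _×-dec_; _→-dec_)
open import Relation.Unary using (Decidable)
open import Relation.Binary.PropositionalEquality using (_≡_; _≢_; _≗_; refl; sym; trans; cong; subst; subst₂)

Extensional : {A B : Set} → ((A → B) → Set) → Set
Extensional P = ∀ {f g} → f ≗ g → P f → P g

any-function? : ∀ m {k} {P : (Fin m → Fin k) → Set} →
                Extensional P → Decidable P → Dec (∃ P)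
any-function? zero P-ext P? with P? (λ ())
... | yes p = yes (_ , p)
... | no ¬p = no λ (f , pf) → ¬p (P-ext (λ ()) pf)
any-function? (suc m) P-ext P?
  with any? (λ x → any-function? m (λ f≗g → P-ext (∷-cong refl f≗g)) (λ t → P? (x ∷ t)))
... | yes (x , t , p) = yes (x ∷ t , p)
... | no ¬p = no λ (f , pf) → ¬p (head f , tail f , P-ext (∷-cong refl (λ _ → refl)) pf)

all-function? : ∀ m {k} {P : (Fin m → Fin k) → Set} →
                Extensional P → Decidable P → Dec (∀ f → P f)
all-function? m {P = P} P-ext P? with any-function? m ¬P-ext (¬? ∘ P?)
  where
  ¬P-ext : Extensional (¬_ ∘ P)
  ¬P-ext f≗g ¬pf pg = ¬pf (P-ext (sym ∘ f≗g) pg)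
... | yes (f , ¬pf) = no λ all-P → ¬pf (all-P f)
... | no ¬∃¬P = yes λ f → decidable-stable (P? f) (λ ¬pf → ¬∃¬P (f , ¬pf))

module _ {P : ℕ → Set} (P? : Decidable P) where

  private
    search : ∀ m d → (∀ j → j < m → ¬ P j) → P (m + d) →
             ∃[ i ] IsMinimum P i × i ≤ m + d
    search m d below p with P? m
    ... | yes pm = m , (pm , λ j pj → ≮⇒≥ (λ j<m → below j j<m pj)) , m≤m+n m d
    search m zero    below p | no ¬pm = contradiction (subst P (+-identityʳ m) p) ¬pm
    search m (suc d) below p | no ¬pm
      with search (suc m) d below′ (subst P (+-suc m d) p)
      where
      below′ : ∀ j → j < suc m → ¬ P j
      below′ j j<1+m with m<1+n⇒m<n∨m≡n j<1+m
      ... | inj₁ j<m  = below j j<m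
      ... | inj₂ refl = ¬pm
    ... | i , i-min , i≤ = i , i-min , ≤-trans i≤ (≤-reflexive (sym (+-suc m d)))

  minimum-≤ : ∀ {k} → P k → ∃[ m ] IsMinimum P m × m ≤ k
  minimum-≤ {k} = search 0 k (λ _ ())

Finer : {A B C : Set} → (A → B) → (A → C) → Set
Finer f g = ∀ x y → f x ≡ f y → g x ≡ g y

Isolates : {A B : Set} → (A → B) → A → Set
Isolates f u = ∀ w → f w ≡ f u → w ≡ u

finer-trans : {A B C D : Set} {f : A → B} {g : A → C} {h : A → D} →
              Finer f g → Finer g h → Finer f h
finer-trans f≤g g≤h x y = g≤h x y ∘ f≤g x y

isolates-finer : {A B C : Set} {f : A → B} {g : A → C} {u : A} →
                 Finer f g → Isolates g u → Isolates f u
isolates-finer f≤g g-u w = g-u w ∘ f≤g w _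

isolate : ∀ {m k} → (Fin m → Fin k) → Fin m → Fin m → Fin (suc k)
isolate f u w with w ≟ u
... | yes _ = Fin.zero
... | no _  = Fin.suc (f w)

module _ {m k} (f : Fin m → Fin k) (u : Fin m) where

  isolate-finer : Finer (isolate f u) f
  isolate-finer x y eq with x ≟ u | y ≟ u
  ... | yes refl | yes refl = refl
  ... | no _     | no _     = suc-injective eq
  isolate-finer x y () | yes _ | no _
  isolate-finer x y () | no _  | yes _

  isolate-isolates : Isolates (isolate f u) u
  isolate-isolates w eq with w ≟ u | u ≟ u
  ... | yes w≡u | _       = w≡u
  ... | no _    | no u≢u  = contradiction refl u≢u
  isolate-isolates w () | no _ | yes _

drop-unused-colors : ∀ {m K} (f : Fin m → Fin K) →
  ∃[ k ] k ≤ K × Σ (Fin m → Fin k) λ g → StrictlySurjective _≡_ g × Finer g f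
drop-unused-colors {K = zero} f = zero , z≤n , f , (λ ()) , (λ _ _ → id)
drop-unused-colors {K = suc K} f with all? (λ i → any? (λ w → f w ≟ i))
... | yes onto = suc K , ≤-refl , f , onto , (λ _ _ → id)
... | no ¬onto with ¬∀⟶∃¬ (suc K) _ (λ i → any? (λ w → f w ≟ i)) ¬onto
... | i , unused with drop-unused-colors (λ w → punchOut {i = i} (λ i≡fw → unused (w , sym i≡fw)))
... | k , k≤K , g , g-onto , g≤f =
  k , m≤n⇒m≤1+n k≤K , g , g-onto , λ x y → punchOut-injective {i = i} _ _ ∘ g≤f x y

module _ (G : Graph) where

  Proper : ∀ {k} → (Vertex G → Fin k) → Set
  Proper f = ∀ x y → Edge G x y → f x ≢ f y

  Rainbow : ∀ {k} → (Vertex G → Fin k) → (Fin k → Vertex G) → Set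
  Rainbow f r = ∀ i → f (r i) ≡ i

  CompelsEdge : ∀ {k} → (Vertex G → Fin k) → Set
  CompelsEdge f = ∀ r → Rainbow f r → ∃[ i ] ∃[ j ] Edge G (r i) (r j)

  EdgeCompellingMap : ∀ k → (Vertex G → Fin k) → Set
  EdgeCompellingMap k f = StrictlySurjective _≡_ f × Proper f × CompelsEdge f

  proper-finer : ∀ {k l} {f : Vertex G → Fin k} {g : Vertex G → Fin l} →
                 Finer f g → Proper g → Proper f
  proper-finer f≤g g-proper x y xy = g-proper x y xy ∘ f≤g x y

  isolated-edge-compels : ∀ {k u v} {f : Vertex G → Fin k} →
    Edge G u v → Isolates f u → Isolates f v → CompelsEdge f
  isolated-edge-compels {u = u} {v} {f} uv u-alone v-alone r rainbow =
    f u , f v , subst₂ (Edge G) (sym (u-alone _ (rainbow (f u)))) (sym (v-alone _ (rainbow (f v)))) uv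

  private
    edge? : ∀ x y → Dec (Edge G x y)
    edge? x y = adj G x y Bool.≟ true

    compelsEdge-ext : ∀ {k} (f : Vertex G → Fin k) →
      Extensional (λ r → Rainbow f r → ∃[ i ] ∃[ j ] Edge G (r i) (r j))
    compelsEdge-ext f r≗s compels rainbow =
      let i , j , e = compels (λ i → trans (cong f (r≗s i)) (rainbow i))
      in i , j , subst₂ (Edge G) (r≗s i) (r≗s j) e

    edgeCompellingMap-ext : ∀ k → Extensional (EdgeCompellingMap k)
    edgeCompellingMap-ext k f≗g (onto , proper , compels) =
      (λ i → let w , fw≡i = onto i in w , trans (sym (f≗g w)) fw≡i) ,
      (λ x y xy gx≡gy → proper x y xy (trans (f≗g x) (trans gx≡gy (sym (f≗g y))))) ,
      (λ r rainbow → compels r (λ i → trans (f≗g (r i)) (rainbow i)))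

    edgeCompellingMap? : ∀ k → Decidable (EdgeCompellingMap k)
    edgeCompellingMap? k f =
      all? (λ i → any? (λ w → f w ≟ i)) ×-dec
      all? (λ x → all? (λ y → edge? x y →-dec ¬? (f x ≟ f y))) ×-dec
      all-function? k (compelsEdge-ext f)
        (λ r → all? (λ i → f (r i) ≟ i) →-dec any? (λ i → any? (λ j → edge? (r i) (r j))))

  edgeCompellingColorable? : ∀ k → Dec (EdgeCompellingColorable G k)
  edgeCompellingColorable? k =
    map′ (λ (f , onto , proper , compels) →
           record { color = f ; nonempty = onto ; proper = proper } , λ (r , rainbow) → compels r rainbow)
         (λ (c , compels) → color c , nonempty c , proper c , λ r rainbow → compels (r , rainbow))
         (any-function? (n G) (edgeCompellingMap-ext k) (edgeCompellingMap? k))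

  isolating-map : ∀ {χ u v} → ProperColoring G χ →
    Σ (Vertex G → Fin (2 + χ)) λ f → Proper f × Isolates f u × Isolates f v
  isolating-map {u = u} {v} c =
    isolate (isolate (color c) u) v ,
    proper-finer (finer-trans (isolate-finer _ v) (isolate-finer _ u)) (proper c) ,
    isolates-finer (isolate-finer _ v) (isolate-isolates _ u) ,
    isolate-isolates _ v

  edgeCompellingColorable-≤2+ : ∀ {χ u v} → ProperColoring G χ → Edge G u v →
    ∃[ k ] k ≤ 2 + χ × EdgeCompellingColorable G k
  edgeCompellingColorable-≤2+ c uv =
    let f , f-proper , f-u , f-v   = isolating-map c
        k , k≤ , g , g-onto , g≤f = drop-unused-colors f
    in k , k≤ ,
       record { color = g ; nonempty = g-onto ; proper = proper-finer g≤f f-proper } ,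
       λ (r , rainbow) → isolated-edge-compels uv (isolates-finer g≤f f-u) (isolates-finer g≤f f-v) r rainbow

mainTheorem5 : (G : Graph) → HasEdge G → (χ : ℕ) → IsChromaticNumber G χ →
    Σ ℕ (λ m → IsEdgeCompellingChromaticNumber G m × χ ≤ m × m ≤ χ + 2)
mainTheorem5 G (_ , _ , uv) χ (c , χ-minimal) =
  let k , k≤2+χ , k-colorable = edgeCompellingColorable-≤2+ G c uv
      m , m-minimal , m≤k       = minimum-≤ (edgeCompellingColorable? G) k-colorable
  in m , m-minimal , χ-minimal m (proj₁ (proj₁ m-minimal)) ,
     ≤-trans m≤k (≤-trans k≤2+χ (≤-reflexive (+-comm 2 χ)))
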